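{- For every graph $G=(V,E)$, $\rho_T(G)=\widehat{\Theta}(G)$.
   Context: Graphs are finite and simple. $G$ is a threshold graph if there are real weights $w(v)$ and a real $t$ with $w(x)+w(y)\ge t$ iff $xy\in E$ for distinct $x,y$. The threshold graph intersection number $\widehat{\Theta}(G)$ is the minimum $k$ such that there exist threshold graphs $G_1,\dots,G_k$ with $G_i=(V,E(G_i))$ (same vertex set as $G$) and $G=\bigcap_{i=1}^k G_i$, i.e. $E=\bigcap_i E(G_i)$. For $u,v\in(\mathbb{R}\cup\{\infty\})^k$, $u\odot v=\min_i(u_i+v_i)$. A min-plus $k$-tropical dot product representation of $G$ is a map $f:V\to(\mathbb{R}\cup\{\infty\})^k$ with threshold $t>0$ such that for distinct $x,y$, $xy\in E$ iff $f(x)\odot f(y)\ge t$; $\rho_T(G)$ is the minimum such $k$.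
   Formalization: The weights $w(v)$ and threshold $t$ of threshold graphs are rational rather than real, and min-plus representations have entries in ℚ ∪ {∞} in place of $\mathbb{R}\cup\{\infty\}$ and a rational threshold. -}

module Defs where

open import Data.Nat using (ℕ; zero; suc)
import Data.Nat as ℕ
open import Data.Fin using (Fin; zero; suc)
open import Data.Bool using (Bool; true; false)
open import Data.Rational using (ℚ; 0ℚ; _+_; _⊓_; _≤_; _<_)
open import Data.Product using (Σ; _×_; ∃)
open import Data.Unit using (⊤)
open import Relation.Binary.PropositionalEquality using (_≡_; _≢_)
open import Relation.Nullary using (¬_)
open import Function.Bundles using (_⇔_)

record Graph (n : ℕ) : Set where
  field
    adj    : Fin n → Fin n → Bool
    sym    : ∀ x y → adj x y ≡ adj y x
    irrefl : ∀ x → adj x x ≡ false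
open Graph public

IsThreshold : ∀ {n} → Graph n → Set
IsThreshold {n} H =
  Σ (Fin n → ℚ) λ w → Σ ℚ λ t →
    ∀ x y → x ≢ y → (adj H x y ≡ true ⇔ t ≤ w x + w y)

ThresholdIntersection : ∀ {n} → Graph n → ℕ → Set
ThresholdIntersection {n} G k =
  Σ (Fin k → Graph n) λ Gs →
    (∀ i → IsThreshold (Gs i)) ×
    (∀ x y → x ≢ y → (adj G x y ≡ true ⇔ (∀ i → adj (Gs i) x y ≡ true)))

data ℚ∞ : Set where
  fin : ℚ → ℚ∞
  ∞   : ℚ∞

_+∞_ : ℚ∞ → ℚ∞ → ℚ∞
fin p +∞ fin q = fin (p + q)
fin _ +∞ ∞     = ∞
∞     +∞ _     = ∞

min∞ : ℚ∞ → ℚ∞ → ℚ∞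
min∞ (fin p) (fin q) = fin (p ⊓ q)
min∞ (fin p) ∞       = fin p
min∞ ∞       b       = b

_≤∞_ : ℚ → ℚ∞ → Set
t ≤∞ fin q = t ≤ q
t ≤∞ ∞     = ⊤

_⊙_ : ∀ {k} → (Fin k → ℚ∞) → (Fin k → ℚ∞) → ℚ∞
_⊙_ {zero}  u v = ∞
_⊙_ {suc k} u v = min∞ (u zero +∞ v zero) ((λ i → u (suc i)) ⊙ (λ i → v (suc i)))

TropicalRep : ∀ {n} → Graph n → ℕ → Set
TropicalRep {n} G k =
  Σ (Fin n → (Fin k → ℚ∞)) λ f → Σ ℚ λ t → (0ℚ < t) ×
    (∀ x y → x ≢ y → (adj G x y ≡ true ⇔ t ≤∞ (f x ⊙ f y)))

IsMinimum : (ℕ → Set) → ℕ → Set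
IsMinimum P k = P k × (∀ m → P m → k ℕ.≤ m)

ThresholdIntersectionNumber : ∀ {n} → Graph n → ℕ → Set
ThresholdIntersectionNumber G = IsMinimum (ThresholdIntersection G)

TropicalRank : ∀ {n} → Graph n → ℕ → Set
TropicalRank G = IsMinimum (TropicalRep G)

module Submission where

-- Each coordinate of a min-plus representation is a threshold rule with weights in ℚ ∪ {∞}, and such
-- a rule admits no alternating 4-cycle (edges ab, cd and non-edges ac, bd), because
-- (a + b) + (c + d) = (a + c) + (b + d). Conversely, a graph without alternating 4-cycles is threshold
-- with threshold 1 (Chvátal–Hammer): a maximum x of the vicinal preorder is dominating, or else every
-- non-neighbour of x is isolated, and such a vertex can be given an extreme weight. So, coordinate by
-- coordinate, k-dimensional representations and intersections of k threshold graphs are the same thing.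
-- The common minimum exists constructively: G has an n-dimensional star representation, and being an
-- intersection of m alternating-4-cycle-free graphs is decided by searching all m adjacency matrices.

open import Defs
open import Data.Nat as ℕ using (ℕ; zero; suc)
import Data.Nat.Properties as ℕ
open import Data.Fin using (Fin; zero; suc; punchIn; punchOut)
open import Data.Fin.Properties
  using (_≟_; all?; any?; ∀-cons-⇔; punchIn-injective; punchInᵢ≢i; punchIn-punchOut)
open import Data.Bool using (Bool; true; false; if_then_else_)
import Data.Bool.Properties as Bool
open import Data.Rational using (ℚ; 0ℚ; 1ℚ; ½; _+_; -_; _-_; _⊓_; _⊔_; _≤_; _<_)
import Data.Rational.Properties as ℚ
open import Data.Vec.Functional using ([]; _∷_; head; tail; insertAt)
open import Data.Vec.Functional.Properties using (insertAt-lookup; insertAt-punchIn)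
import Data.Vec.Functional.Relation.Binary.Equality.Setoid as Pointwise
open import Data.Product using (Σ; _×_; _,_; proj₁; proj₂; ∃)
open import Data.Product.Function.NonDependent.Propositional using (_×-⇔_)
open import Data.Sum using (_⊎_; inj₁; inj₂; [_,_]′)
open import Data.Unit using (tt)
open import Data.Empty using (⊥; ⊥-elim)
open import Function using (_∘_; id)
open import Function.Bundles using (_⇔_; mk⇔; Equivalence)
import Function.Properties.Equivalence as ⇔
open import Function.Definitions using (Injective)
open import Level using (0ℓ)
open import Algebra.Bundles using (CommutativeMonoid)
open import Algebra.Properties.CommutativeSemigroup
  (CommutativeMonoid.commutativeSemigroup ℚ.+-0-commutativeMonoid) using (interchange)
open import Relation.Binary using (Rel; Setoid; Reflexive; Transitive; Total; _Respects_)
import Relation.Binary.PropositionalEquality as ≡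
open ≡ using (_≡_; _≢_; refl)
open import Relation.Nullary using (¬_; Dec; yes; no; does; contradiction)
open import Relation.Nullary.Decidable using (¬?; _×-dec_; _⊎-dec_; _→-dec_; map; map′)
open import Relation.Unary using (Pred; Decidable)

open Equivalence using (to; from)

∀-cong-⇔ : ∀ {k} {P Q : Fin k → Set} → (∀ i → P i ⇔ Q i) → (∀ i → P i) ⇔ (∀ i → Q i)
∀-cong-⇔ P⇔Q = mk⇔ (λ p i → to (P⇔Q i) (p i)) (λ q i → from (P⇔Q i) (q i))

_⇔?_ : ∀ {A B : Set} → Dec A → Dec B → Dec (A ⇔ B)
a? ⇔? b? = map′ (λ (f , g) → mk⇔ f g) (λ e → to e , from e) ((a? →-dec b?) ×-dec (b? →-dec a?))

does⇔ : ∀ {A : Set} (a? : Dec A) → (does a? ≡ true) ⇔ A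
does⇔ (yes a) = mk⇔ (λ _ → a) (λ _ → refl)
does⇔ (no ¬a) = mk⇔ (λ ()) (λ a → contradiction a ¬a)

true≢false : ∀ {b} → b ≡ true → b ≡ false → ⊥
true≢false refl ()

+∞-comm : ∀ a b → a +∞ b ≡ b +∞ a
+∞-comm (fin p) (fin q) = ≡.cong fin (ℚ.+-comm p q)
+∞-comm (fin _) ∞       = refl
+∞-comm ∞       (fin _) = refl
+∞-comm ∞       ∞       = refl

_≤∞?_ : ∀ t a → Dec (t ≤∞ a)
t ≤∞? fin q = t ℚ.≤? q
t ≤∞? ∞     = yes tt

≤∞-min∞ : ∀ t a b → t ≤∞ min∞ a b ⇔ (t ≤∞ a × t ≤∞ b)
≤∞-min∞ t (fin p) (fin q) =
  mk⇔ (λ t≤ → ℚ.≤-trans t≤ (ℚ.p⊓q≤p p q) , ℚ.≤-trans t≤ (ℚ.p⊓q≤q p q))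
      (λ (t≤p , t≤q) → ℚ.⊓-glb t≤p t≤q)
≤∞-min∞ t (fin p) ∞ = mk⇔ (_, tt) proj₁
≤∞-min∞ t ∞       b = mk⇔ (tt ,_) proj₂

≤∞-⊙ : ∀ {k} t (u v : Fin k → ℚ∞) → t ≤∞ (u ⊙ v) ⇔ (∀ i → t ≤∞ (u i +∞ v i))
≤∞-⊙ {zero}  t u v = mk⇔ (λ _ ()) (λ _ → tt)
≤∞-⊙ {suc k} t u v =
  ⇔.trans (≤∞-min∞ t _ _) (⇔.trans (⇔.refl ×-⇔ ≤∞-⊙ t (tail u) (tail v)) ∀-cons-⇔)

Realises : ∀ {n} → Graph n → (Fin n → ℚ∞) → ℚ → Set
Realises H a t = ∀ x y → x ≢ y → (adj H x y ≡ true ⇔ t ≤∞ (a x +∞ a y))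

AlternatingC4Free : ∀ {n} → (Fin n → Fin n → Bool) → Set
AlternatingC4Free A = ∀ a b c d → a ≢ c → b ≢ d →
  A a b ≡ true → A c d ≡ true → A a c ≡ false → A b d ≡ false → ⊥

alternatingC4Free? : ∀ {n} (A : Fin n → Fin n → Bool) → Dec (AlternatingC4Free A)
alternatingC4Free? A = all? λ a → all? λ b → all? λ c → all? λ d →
  ¬? (a ≟ c) →-dec ¬? (b ≟ d) →-dec (A a b Bool.≟ true) →-dec (A c d Bool.≟ true) →-dec
  (A a c Bool.≟ false) →-dec (A b d Bool.≟ false) →-dec no (λ ())

alternatingC4Free-resp : ∀ {n} {A B : Fin n → Fin n → Bool} →
  (∀ x y → A x y ≡ B x y) → AlternatingC4Free A → AlternatingC4Free B
alternatingC4Free-resp A≗B free a b c d a≢c b≢d ab cd ac bd =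
  free a b c d a≢c b≢d
    (≡.trans (A≗B a b) ab) (≡.trans (A≗B c d) cd) (≡.trans (A≗B a c) ac) (≡.trans (A≗B b d) bd)

alternatingC4Free-reindex : ∀ {m n} {A : Fin n → Fin n → Bool} {ι : Fin m → Fin n} →
  Injective _≡_ _≡_ ι → AlternatingC4Free A → AlternatingC4Free (λ x y → A (ι x) (ι y))
alternatingC4Free-reindex ι-inj free a b c d a≢c b≢d =
  free _ _ _ _ (a≢c ∘ ι-inj) (b≢d ∘ ι-inj)

-- (a + c) + (b + d) = (a + b) + (c + d) ≥ t + t, so a + c ≥ t or b + d ≥ t.
≤∞-interchange : ∀ t (a b c d : ℚ∞) →
  t ≤∞ (a +∞ b) → t ≤∞ (c +∞ d) → ¬ t ≤∞ (a +∞ c) → ¬ t ≤∞ (b +∞ d) → ⊥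
≤∞-interchange t ∞       _       _       _       _ _ t≰ac _ = t≰ac tt
≤∞-interchange t (fin _) _       ∞       _       _ _ t≰ac _ = t≰ac tt
≤∞-interchange t (fin _) ∞       (fin _) _       _ _ _ t≰bd = t≰bd tt
≤∞-interchange t (fin _) (fin _) (fin _) ∞       _ _ _ t≰bd = t≰bd tt
≤∞-interchange t (fin p) (fin q) (fin r) (fin s) t≤ab t≤cd t≰ac t≰bd =
  ℚ.<-irrefl refl (ℚ.≤-<-trans (ℚ.+-mono-≤ t≤ab t≤cd)
    (≡.subst (_< t + t) (≡.sym (interchange p q r s)) (ℚ.+-mono-< (ℚ.≰⇒> t≰ac) (ℚ.≰⇒> t≰bd))))

adjacent⇒≢ : ∀ {n} (H : Graph n) {x y} → adj H x y ≡ true → x ≢ y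
adjacent⇒≢ H {x} xy refl = true≢false xy (irrefl H x)

realises⇒alternatingC4Free : ∀ {n} {H : Graph n} {a t} → Realises H a t → AlternatingC4Free (adj H)
realises⇒alternatingC4Free {H = H} {a} {t} R p q r s p≢r q≢s pq rs pr qs =
  ≤∞-interchange t (a p) (a q) (a r) (a s)
    (to (R p q (adjacent⇒≢ H pq)) pq) (to (R r s (adjacent⇒≢ H rs)) rs)
    (λ t≤pr → true≢false (from (R p r p≢r) t≤pr) pr)
    (λ t≤qs → true≢false (from (R q s q≢s) t≤qs) qs)

isThreshold⇒alternatingC4Free : ∀ {n} {H : Graph n} → IsThreshold H → AlternatingC4Free (adj H)
isThreshold⇒alternatingC4Free {H = H} (w , t , R) = realises⇒alternatingC4Free {H = H} {fin ∘ w} {t} R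

_≼[_]_ : ∀ {n} → Fin n → Graph n → Fin n → Set
z ≼[ H ] x = ∀ u → u ≢ x → adj H z u ≡ true → adj H x u ≡ true

≼-refl : ∀ {n} (H : Graph n) → Reflexive (_≼[ H ]_)
≼-refl H u _ zu = zu

≼-trans : ∀ {n} (H : Graph n) → Transitive (_≼[ H ]_)
≼-trans H {a} {b} {c} a≼b b≼c u u≢c au with u ≟ b | a ≟ c
... | no u≢b   | _        = b≼c u u≢c (a≼b u u≢b au)
... | yes refl | yes refl = au
... | yes refl | no a≢c   =
  ≡.trans (sym H c u)
    (a≼b c (u≢c ∘ ≡.sym) (≡.trans (sym H a c) (b≼c a a≢c (≡.trans (sym H u a) au))))

≼-total : ∀ {n} (H : Graph n) → AlternatingC4Free (adj H) → Total (_≼[ H ]_)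
≼-total H free z x
  with any? (λ u → ¬? (u ≟ x) ×-dec (adj H z u Bool.≟ true) ×-dec (adj H x u Bool.≟ false))
... | no ∄u = inj₁ λ u u≢x zu → Bool.¬-not λ xu → ∄u (u , u≢x , zu , xu)
... | yes (u , u≢x , zu , xu) = inj₂ λ v v≢z xv → Bool.¬-not λ zv →
  free z u v x (v≢z ∘ ≡.sym) u≢x zu (≡.trans (sym H v x) xv) zv (≡.trans (sym H u x) xu)

maximum : ∀ {n ℓ} (_≤_ : Rel (Fin (suc n)) ℓ) → Reflexive _≤_ → Transitive _≤_ → Total _≤_ →
  ∃ λ x → ∀ z → z ≤ x
maximum {zero}  _≤_ ≤-refl ≤-trans ≤-total = zero , λ { zero → ≤-refl }
maximum {suc n} _≤_ ≤-refl ≤-trans ≤-total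
  with maximum (λ i j → suc i ≤ suc j) ≤-refl ≤-trans (λ i j → ≤-total (suc i) (suc j))
... | m , m-max with ≤-total zero (suc m)
...   | inj₁ 0≤m = suc m , λ { zero → 0≤m ; (suc z) → m-max z }
...   | inj₂ m≤0 = zero , λ { zero → ≤-refl ; (suc z) → ≤-trans (m-max z) m≤0 }

Dominating Isolated : ∀ {n} → Graph n → Fin n → Set
Dominating H v = ∀ y → y ≢ v → adj H v y ≡ true
Isolated   H v = ∀ y → adj H v y ≡ false

dominatingOrIsolated : ∀ {n} (H : Graph (suc n)) → AlternatingC4Free (adj H) →
  ∃ λ v → Dominating H v ⊎ Isolated H v
dominatingOrIsolated H free with maximum (_≼[ H ]_) (≼-refl H) (≼-trans H) (≼-total H free)
... | x , x-max with any? (λ y → ¬? (y ≟ x) ×-dec (adj H x y Bool.≟ false))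
...   | no ∄y = x , inj₁ λ y y≢x → Bool.¬-not λ xy → ∄y (y , y≢x , xy)
...   | yes (y , y≢x , xy) = y , inj₂ λ z → Bool.¬-not λ yz →
  true≢false (x-max z y y≢x (≡.trans (sym H z y) yz)) xy

removeVertex : ∀ {n} → Graph (suc n) → Fin (suc n) → Graph n
removeVertex H v = record
  { adj    = λ x y → adj H (punchIn v x) (punchIn v y)
  ; sym    = λ x y → sym H (punchIn v x) (punchIn v y)
  ; irrefl = λ x → irrefl H (punchIn v x)
  }

data PunchInView {n} (v : Fin (suc n)) : Fin (suc n) → Set where
  at      : PunchInView v v
  punched : ∀ j → PunchInView v (punchIn v j)

punchInView : ∀ {n} (v x : Fin (suc n)) → PunchInView v x
punchInView v x with v ≟ x
... | yes refl = at
... | no v≢x   = ≡.subst (PunchInView v) (punchIn-punchOut v≢x) (punched (punchOut v≢x))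

UnitWeights : ∀ {n} → Graph n → Set
UnitWeights {n} H = Σ (Fin n → ℚ) λ w → Realises H (fin ∘ w) 1ℚ

realises-insertAt : ∀ {n} (H : Graph (suc n)) v {w : Fin n → ℚ} {c} →
  Realises (removeVertex H v) (fin ∘ w) 1ℚ →
  (∀ j → adj H v (punchIn v j) ≡ true ⇔ 1ℚ ≤ c + w j) →
  Realises H (fin ∘ insertAt w v c) 1ℚ
realises-insertAt H v {w} {c} R Rv x y x≢y with punchInView v x | punchInView v y
... | at        | at        = contradiction refl x≢y
... | at        | punched j
  rewrite insertAt-lookup w v c | insertAt-punchIn w v c j = Rv j
... | punched i | at
  rewrite insertAt-lookup w v c | insertAt-punchIn w v c i
        | sym H (punchIn v i) v | ℚ.+-comm (w i) c = Rv i
... | punched i | punched j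
  rewrite insertAt-punchIn w v c i | insertAt-punchIn w v c j = R i j (x≢y ∘ ≡.cong (punchIn v))

upperBound : ∀ {n} (f : Fin n → ℚ) → ∃ λ U → ∀ i → f i ≤ U
upperBound {zero}  f = 0ℚ , λ ()
upperBound {suc n} f with upperBound (tail f)
... | U , f≤U =
  f zero ⊔ U , λ { zero → ℚ.p≤p⊔q (f zero) U ; (suc i) → ℚ.p≤q⇒p≤r⊔q (f zero) (f≤U i) }

lowerBound : ∀ {n} (f : Fin n → ℚ) → ∃ λ L → ∀ i → L ≤ f i
lowerBound {zero}  f = 0ℚ , λ ()
lowerBound {suc n} f with lowerBound (tail f)
... | L , L≤f =
  f zero ⊓ L , λ { zero → ℚ.p⊓q≤p (f zero) L ; (suc i) → ℚ.p≤q⇒r⊓p≤q (f zero) (L≤f i) }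

1≤[1-p]+q : ∀ {p q} → p ≤ q → 1ℚ ≤ (1ℚ - p) + q
1≤[1-p]+q {p} {q} p≤q = begin
  1ℚ             ≡⟨ ℚ.+-identityʳ 1ℚ ⟨
  1ℚ + 0ℚ        ≡⟨ ≡.cong (1ℚ +_) (ℚ.+-inverseˡ p) ⟨
  1ℚ + (- p + p) ≡⟨ ℚ.+-assoc 1ℚ (- p) p ⟨
  (1ℚ - p) + p   ≤⟨ ℚ.+-monoʳ-≤ (1ℚ - p) p≤q ⟩
  (1ℚ - p) + q   ∎
  where open ℚ.≤-Reasoning

-q+p<1 : ∀ {p q} → p ≤ q → - q + p < 1ℚ
-q+p<1 {p} {q} p≤q = begin-strict
  - q + p ≤⟨ ℚ.+-monoʳ-≤ (- q) p≤q ⟩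
  - q + q ≡⟨ ℚ.+-inverseˡ q ⟩
  0ℚ      <⟨ ℚ.positive⁻¹ 1ℚ ⟩
  1ℚ      ∎
  where open ℚ.≤-Reasoning

dominatingWeight : ∀ {n} {H : Graph (suc n)} {v} (w : Fin n → ℚ) → Dominating H v →
  ∃ λ c → ∀ j → adj H v (punchIn v j) ≡ true ⇔ 1ℚ ≤ c + w j
dominatingWeight {v = v} w dom with lowerBound w
... | L , L≤w = 1ℚ - L , λ j →
  mk⇔ (λ _ → 1≤[1-p]+q (L≤w j)) (λ _ → dom (punchIn v j) (punchInᵢ≢i v j))

isolatedWeight : ∀ {n} {H : Graph (suc n)} {v} (w : Fin n → ℚ) → Isolated H v →
  ∃ λ c → ∀ j → adj H v (punchIn v j) ≡ true ⇔ 1ℚ ≤ c + w j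
isolatedWeight {v = v} w iso with upperBound w
... | U , w≤U = - U , λ j →
  mk⇔ (λ vj → contradiction (iso (punchIn v j)) (Bool.not-¬ vj))
      (λ 1≤ → contradiction (ℚ.<-≤-trans (-q+p<1 (w≤U j)) 1≤) (ℚ.<-irrefl refl))

alternatingC4Free⇒unitWeights : ∀ {n} (H : Graph n) → AlternatingC4Free (adj H) → UnitWeights H
alternatingC4Free⇒unitWeights {zero}  H _    = (λ ()) , λ ()
alternatingC4Free⇒unitWeights {suc n} H free with dominatingOrIsolated H free
... | v , dom-or-iso
  with alternatingC4Free⇒unitWeights (removeVertex H v)
         (alternatingC4Free-reindex (punchIn-injective v _ _) free)
...   | w , R with [ dominatingWeight {H = H} w , isolatedWeight {H = H} w ]′ dom-or-iso
...     | c , Rv = insertAt w v c , realises-insertAt H v R Rv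

isThreshold⇒unitWeights : ∀ {n} {H : Graph n} → IsThreshold H → UnitWeights H
isThreshold⇒unitWeights {H = H} = alternatingC4Free⇒unitWeights H ∘ isThreshold⇒alternatingC4Free {H = H}

unitWeights⇒isThreshold : ∀ {n} {H : Graph n} → UnitWeights H → IsThreshold H
unitWeights⇒isThreshold (w , R) = w , 1ℚ , R

alternatingC4Free⇒isThreshold : ∀ {n} (H : Graph n) → AlternatingC4Free (adj H) → IsThreshold H
alternatingC4Free⇒isThreshold H = unitWeights⇒isThreshold {H = H} ∘ alternatingC4Free⇒unitWeights H

simpleGraph : ∀ {n} (R : Fin n → Fin n → Bool) → (∀ x y → R x y ≡ R y x) → Graph n
simpleGraph R R-sym = record
  { adj    = λ x y → if does (x ≟ y) then false else R x y
  ; sym    = adj-sym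
  ; irrefl = adj-irrefl
  }
  where
  adj-sym : ∀ x y → (if does (x ≟ y) then false else R x y) ≡ (if does (y ≟ x) then false else R y x)
  adj-sym x y with x ≟ y | y ≟ x
  ... | yes _   | yes _   = refl
  ... | yes x≡y | no y≢x  = contradiction (≡.sym x≡y) y≢x
  ... | no x≢y  | yes y≡x = contradiction (≡.sym y≡x) x≢y
  ... | no _    | no _    = R-sym x y
  adj-irrefl : ∀ x → (if does (x ≟ x) then false else R x x) ≡ false
  adj-irrefl x with x ≟ x
  ... | yes _   = refl
  ... | no x≢x  = contradiction refl x≢x

simpleGraph-adj : ∀ {n} (R : Fin n → Fin n → Bool) R-sym {x y} → x ≢ y →
  adj (simpleGraph R R-sym) x y ≡ R x y
simpleGraph-adj R R-sym {x} {y} x≢y with x ≟ y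
... | yes x≡y = contradiction x≡y x≢y
... | no _    = refl

tropicalRep⇒thresholdIntersection : ∀ {n k} {G : Graph n} → TropicalRep G k → ThresholdIntersection G k
tropicalRep⇒thresholdIntersection {n} {k} {G} (f , t , _ , R) =
  coordinate ,
  (λ i → alternatingC4Free⇒isThreshold (coordinate i)
           (realises⇒alternatingC4Free {H = coordinate i} (coordinate-realises i))) ,
  λ x y x≢y → ⇔.trans (R x y x≢y)
    (⇔.trans (≤∞-⊙ t (f x) (f y)) (∀-cong-⇔ λ i → ⇔.sym (coordinate-realises i x y x≢y)))
  where
  related : Fin k → Fin n → Fin n → Bool
  related i x y = does (t ≤∞? (f x i +∞ f y i))
  related-sym : ∀ i x y → related i x y ≡ related i y x
  related-sym i x y = ≡.cong (does ∘ (t ≤∞?_)) (+∞-comm (f x i) (f y i))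
  coordinate : Fin k → Graph n
  coordinate i = simpleGraph (related i) (related-sym i)
  coordinate-realises : ∀ i → Realises (coordinate i) (λ x → f x i) t
  coordinate-realises i x y x≢y
    rewrite simpleGraph-adj (related i) (related-sym i) x≢y = does⇔ (t ≤∞? (f x i +∞ f y i))

thresholdIntersection⇒tropicalRep : ∀ {n k} {G : Graph n} → ThresholdIntersection G k → TropicalRep G k
thresholdIntersection⇒tropicalRep {n} {k} (Gs , Gs-threshold , R) =
  f , 1ℚ , ℚ.positive⁻¹ 1ℚ , λ x y x≢y →
    ⇔.trans (R x y x≢y)
      (⇔.trans (∀-cong-⇔ λ i → proj₂ (weights i) x y x≢y) (⇔.sym (≤∞-⊙ 1ℚ (f x) (f y))))
  where
  weights : ∀ i → UnitWeights (Gs i)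
  weights i = isThreshold⇒unitWeights {H = Gs i} (Gs-threshold i)
  f : Fin n → Fin k → ℚ∞
  f x i = fin (proj₁ (weights i) x)

thresholdIntersection⇔tropicalRep : ∀ {n} (G : Graph n) k → ThresholdIntersection G k ⇔ TropicalRep G k
thresholdIntersection⇔tropicalRep G k =
  mk⇔ (thresholdIntersection⇒tropicalRep {G = G}) (tropicalRep⇒thresholdIntersection {G = G})

-- Without function extensionality, searching Fin k → A needs predicates invariant under pointwise equality.
Searchable : Setoid 0ℓ 0ℓ → Set₁
Searchable S = ∀ {P : Pred (Setoid.Carrier S) 0ℓ} →
  P Respects (Setoid._≈_ S) → Decidable P → Dec (∃ P)

searchable-Bool : Searchable (≡.setoid Bool)
searchable-Bool _ P? =
  map′ [ (true ,_) , (false ,_) ]′ (λ { (true , p) → inj₁ p ; (false , p) → inj₂ p })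
       (P? true ⊎-dec P? false)

searchable-Vector : ∀ (S : Setoid 0ℓ 0ℓ) → Searchable S → ∀ k → Searchable (Pointwise.≋-setoid S k)
searchable-Vector S search zero    P-resp P? = map′ ([] ,_) (λ (_ , p) → P-resp (λ ()) p) (P? [])
searchable-Vector S search (suc k) {P} P-resp P? =
  map′ (λ (a , v , p) → a ∷ v , p) (λ (v , p) → head v , tail v , P-resp η p)
       (search head-resp λ a → searchable-Vector S search k (tail-resp a) (P? ∘ (a ∷_)))
  where
  open Setoid S using (_≈_) renaming (refl to ≈-refl)
  open Pointwise S using (_≋_)
  η : ∀ {v} → v ≋ (head v ∷ tail v)
  η = λ { zero → ≈-refl ; (suc i) → ≈-refl }
  head-resp : (λ a → ∃ λ v → P (a ∷ v)) Respects _≈_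
  head-resp a≈b (v , p) = v , P-resp (λ { zero → a≈b ; (suc i) → ≈-refl }) p
  tail-resp : ∀ a → (λ v → P (a ∷ v)) Respects _≋_
  tail-resp a v≋w = P-resp λ { zero → ≈-refl ; (suc i) → v≋w i }

IsAdjacency : ∀ {n} → (Fin n → Fin n → Bool) → Set
IsAdjacency A = (∀ x y → A x y ≡ A y x) × (∀ x → A x x ≡ false)

isAdjacency? : ∀ {n} (A : Fin n → Fin n → Bool) → Dec (IsAdjacency A)
isAdjacency? A = (all? λ x → all? λ y → A x y Bool.≟ A y x) ×-dec (all? λ x → A x x Bool.≟ false)

isAdjacency-resp : ∀ {n} {A B : Fin n → Fin n → Bool} →
  (∀ x y → A x y ≡ B x y) → IsAdjacency A → IsAdjacency B
isAdjacency-resp A≗B (A-sym , A-irrefl) =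
  (λ x y → ≡.trans (≡.sym (A≗B x y)) (≡.trans (A-sym x y) (A≗B y x))) ,
  (λ x → ≡.trans (≡.sym (A≗B x x)) (A-irrefl x))

C4FreeIntersection : ∀ {n} → Graph n → ∀ m → (Fin m → Fin n → Fin n → Bool) → Set
C4FreeIntersection G m M = (∀ i → IsAdjacency (M i) × AlternatingC4Free (M i)) ×
  (∀ x y → x ≢ y → (adj G x y ≡ true ⇔ (∀ i → M i x y ≡ true)))

c4FreeIntersection? : ∀ {n} (G : Graph n) m → Decidable (C4FreeIntersection G m)
c4FreeIntersection? G m M = (all? λ i → isAdjacency? (M i) ×-dec alternatingC4Free? (M i)) ×-dec
  (all? λ x → all? λ y →
    ¬? (x ≟ y) →-dec ((adj G x y Bool.≟ true) ⇔? (all? λ i → M i x y Bool.≟ true)))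

c4FreeIntersection-resp : ∀ {n} {G : Graph n} {m} {M N : Fin m → Fin n → Fin n → Bool} →
  (∀ i x y → M i x y ≡ N i x y) → C4FreeIntersection G m M → C4FreeIntersection G m N
c4FreeIntersection-resp M≗N (M-free , R) =
  (λ i → isAdjacency-resp (M≗N i) (proj₁ (M-free i)) , alternatingC4Free-resp (M≗N i) (proj₂ (M-free i))) ,
  λ x y x≢y → ⇔.trans (R x y x≢y)
    (∀-cong-⇔ λ i → mk⇔ (≡.trans (≡.sym (M≗N i x y))) (≡.trans (M≗N i x y)))

thresholdIntersection⇔c4FreeIntersection : ∀ {n} (G : Graph n) m →
  ThresholdIntersection G m ⇔ ∃ (C4FreeIntersection G m)
thresholdIntersection⇔c4FreeIntersection G m = mk⇔
  (λ (Gs , Gs-threshold , R) →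
    adj ∘ Gs ,
    (λ i → (sym (Gs i) , irrefl (Gs i)) , isThreshold⇒alternatingC4Free {H = Gs i} (Gs-threshold i)) ,
    R)
  (λ (M , M-free , R) →
    let graph i = record { adj = M i ; sym = proj₁ (proj₁ (M-free i)) ; irrefl = proj₂ (proj₁ (M-free i)) }
    in graph , (λ i → alternatingC4Free⇒isThreshold (graph i) (proj₂ (M-free i))) , R)

thresholdIntersection? : ∀ {n} (G : Graph n) m → Dec (ThresholdIntersection G m)
thresholdIntersection? {n} G m =
  map (⇔.sym (thresholdIntersection⇔c4FreeIntersection G m))
      (searchMatrices (c4FreeIntersection-resp {G = G}) (c4FreeIntersection? G m))
  where
  Row    = Pointwise.≋-setoid (≡.setoid Bool) n
  Matrix = Pointwise.≋-setoid Row n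
  searchMatrices =
    searchable-Vector Matrix (searchable-Vector Row (searchable-Vector (≡.setoid Bool) searchable-Bool n) n) m

starEntry : Bool → Bool → ℚ∞
starEntry true  _     = fin 0ℚ
starEntry false true  = ∞
starEntry false false = fin ½

-- Coordinate x of vertex y. Coordinate x alone realises the graph keeping the edges of G at x and
-- joining all other pairs; G is the intersection of these n graphs.
star : ∀ {n} → Graph n → Fin n → Fin n → ℚ∞
star G y x = starEntry (does (x ≟ y)) (adj G x y)

star-edge : ∀ {n} (G : Graph n) {y z} → y ≢ z → adj G y z ≡ true → ∀ x → 1ℚ ≤∞ (star G y x +∞ star G z x)
star-edge G {y} {z} y≢z yz x with x ≟ y | x ≟ z
... | yes refl | yes refl = contradiction refl y≢z
... | yes refl | no _     rewrite yz = tt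
... | no _     | yes refl rewrite ≡.trans (sym G z y) yz = tt
... | no _     | no _     with adj G x y | adj G x z
...   | true  | _     = tt
...   | false | true  = tt
...   | false | false = ℚ.≤-refl

star-diagonal : ∀ {n} (G : Graph n) {y z} → y ≢ z → 1ℚ ≤∞ (star G y y +∞ star G z y) → adj G y z ≡ true
star-diagonal G {y} {z} y≢z 1≤ with y ≟ y | y ≟ z
... | no y≢y  | _       = contradiction refl y≢y
... | yes _   | yes y≡z = contradiction y≡z y≢z
... | yes _   | no _    with adj G y z
...   | true  = refl
...   | false = ⊥-elim (ℚ.≤⇒≤ᵇ 1≤)

starRepresentation : ∀ {n} (G : Graph n) → TropicalRep G n
starRepresentation G = star G , 1ℚ , ℚ.positive⁻¹ 1ℚ , λ y z y≢z →
  ⇔.trans (mk⇔ (star-edge G y≢z) (λ 1≤ → star-diagonal G y≢z (1≤ y)))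
          (⇔.sym (≤∞-⊙ 1ℚ (star G y) (star G z)))

minimumBelow : ∀ (P : ℕ → Set) → Decidable P → ∀ N → ∃ (IsMinimum P) ⊎ (∀ m → m ℕ.< N → ¬ P m)
minimumBelow P P? zero = inj₂ λ _ ()
minimumBelow P P? (suc N) with minimumBelow P P? N | P? N
... | inj₁ minimum | _      = inj₁ minimum
... | inj₂ none    | yes pN = inj₁ (N , pN , λ m pm → ℕ.≮⇒≥ λ m<N → none m m<N pm)
... | inj₂ none    | no ¬pN = inj₂ λ m m<1+N pm →
  [ (λ m<N → none m m<N pm) , (λ { refl → ¬pN pm }) ]′ (ℕ.m<1+n⇒m<n∨m≡n m<1+N)

minimum : ∀ (P : ℕ → Set) → Decidable P → ∀ {N} → P N → ∃ (IsMinimum P)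
minimum P P? {N} pN =
  [ id , (λ none → contradiction pN (none N (ℕ.n<1+n N))) ]′ (minimumBelow P P? (suc N))

isMinimum-cong : ∀ {P Q : ℕ → Set} {k} → (∀ m → P m ⇔ Q m) → IsMinimum P k → IsMinimum Q k
isMinimum-cong P⇔Q (pk , k-least) = to (P⇔Q _) pk , λ m qm → k-least m (from (P⇔Q m) qm)

mainTheorem7 : ∀ (n : ℕ) (G : Graph n) →
    Σ ℕ λ k → ThresholdIntersectionNumber G k × TropicalRank G k
mainTheorem7 n G
  with minimum (ThresholdIntersection G) (thresholdIntersection? G)
               (from (thresholdIntersection⇔tropicalRep G n) (starRepresentation G))
... | k , k-minimum = k , k-minimum , isMinimum-cong (thresholdIntersection⇔tropicalRep G) k-minimum
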